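{- Let $\mathrm{H}$ be a finite group and $\sigma\in\mathrm{Aut}(\mathrm{H})$ with $\sigma^2=\mathrm{Id}$. If $2$ divides the index $[\mathrm{H}:\mathrm{Fix}(\sigma)]$, then $2$ divides $|\mathrm{Fix}(\sigma)|$.
   Context: $\mathrm{Fix}(\sigma)=\{h\in\mathrm{H} : \sigma(h)=h\}$. -}

module Defs where

open import Data.Nat using (ℕ; zero; suc; _/_)
open import Data.Fin using (Fin; _≟_)
open import Data.List using (List; length; filter; allFin)
open import Relation.Binary.PropositionalEquality using (_≡_)

-- A finite group of order n is represented on the carrier Fin n
-- (every finite group is isomorphic to one of this form), with
-- group laws w.r.t. propositional equality via the stdlib 'IsGroup'.

Fix : {n : ℕ} → (Fin n → Fin n) → List (Fin n)
Fix {n} σ = filter (λ h → σ h ≟ h) (allFin n)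

∣Fix∣ : {n : ℕ} → (Fin n → Fin n) → ℕ
∣Fix∣ σ = length (Fix σ)

-- Index [H : K] = |H| / |K| (K a subgroup, so |K| ≥ 1; the zero case never arises).
index : ℕ → ℕ → ℕ
index h zero = zero
index h (suc k) = h / suc k

{-# OPTIONS --safe #-}
module Submission where

-- Fix(σ) is a subgroup, so by Lagrange |H| = [H : Fix(σ)] · |Fix(σ)|, which
-- is even.  The involution σ pairs off the elements it moves, so
-- |H| − |Fix(σ)| is even as well.

open import Defs
open import Data.Nat using (ℕ; zero; suc; _+_; _*_; _<_; z≤n; s≤s)
open import Data.Nat.Divisibility using (_∣_)
open import Data.Fin using (Fin)
open import Algebra.Structures using (IsGroup)
open import Function.Definitions using (Bijective)
open import Relation.Binary.PropositionalEquality using (_≡_)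

open import Level using (Level)
open import Algebra.Bundles using (Group)
open import Algebra.Core using (Op₁; Op₂)
import Algebra.Properties.Group as GroupProperties
import Algebra.Properties.Monoid as MonoidProperties
open import Data.Bool using (true; false; if_then_else_; _∧_; not)
open import Data.Empty using (⊥-elim)
open import Data.Fin as Fin using (zero; suc; _≟_)
open import Data.Fin.Permutation using (Permutation′; permutation; _⟨$⟩ʳ_)
open import Data.Fin.Properties using (any?; <-irrefl; <-asym; <-cmp)
open import Data.List using (length; filter; tabulate)
open import Data.Nat.Divisibility using (_∣0; ∣-refl; ∣-trans; ∣m∣n⇒∣m+n; ∣m+n∣m⇒∣n; m∣m*n; m/n∣m)
open import Data.Nat.Induction using (<-wellFounded)
open import Data.Nat.Properties as ℕ using (+-comm; +-identityʳ; m≤n+m; m<n+m; <-≤-trans)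
open import Algebra.Properties.CommutativeMonoid.Sum ℕ.+-0-commutativeMonoid
  using (sum; sum-cong-≗; ∑-distrib-+; sum-permute; sum-replicate-zero)
open import Data.Product using (_×_; _,_; proj₁; proj₂; ∃-syntax)
open import Function using (_∘_; id; mk⇔)
open import Induction.WellFounded using (Acc; acc)
open import Relation.Binary using (Rel; _Respects_; IsDecEquivalence; tri<; tri≈; tri>)
open import Relation.Binary.PropositionalEquality
  using (_≢_; refl; sym; trans; cong; cong₂; subst; module ≡-Reasoning)
open import Relation.Nullary using (yes; no; does; ¬_)
open import Relation.Nullary.Decidable using (dec-true; dec-false; does-⇔)
open import Relation.Unary using (Pred; Decidable; ∁; _∩_; _≐_)
open import Relation.Unary.Properties using (U?; ∁?; _∩?_)

private
  variable
    a ℓ ℓ′ : Level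
    A : Set a
    n : ℕ

indicator : {P : Pred (Fin n) ℓ} → Decidable P → Fin n → ℕ
indicator P? i = if does (P? i) then 1 else 0

count : {P : Pred (Fin n) ℓ} → Decidable P → ℕ
count P? = sum (indicator P?)

count-U : count (U? {A = Fin n}) ≡ n
count-U {zero}  = refl
count-U {suc n} = cong suc (count-U {n})

module _ {P : Pred (Fin n) ℓ} (P? : Decidable P) where

  count-cong : {Q : Pred (Fin n) ℓ′} (Q? : Decidable Q) → P ≐ Q → count P? ≡ count Q?
  count-cong Q? (P⊆Q , Q⊆P) =
    sum-cong-≗ (λ i → cong (λ b → if b then 1 else 0) (does-⇔ (mk⇔ P⊆Q Q⊆P) (P? i) (Q? i)))

  count-split : {Q : Pred (Fin n) ℓ′} (Q? : Decidable Q) →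
                count P? ≡ count (P? ∩? Q?) + count (P? ∩? ∁? Q?)
  count-split Q? = trans (sum-cong-≗ (λ i → split (does (P? i)) (does (Q? i))))
                         (∑-distrib-+ (indicator (P? ∩? Q?)) (indicator (P? ∩? ∁? Q?)))
    where
    split : ∀ b c → (if b then 1 else 0) ≡ (if b ∧ c then 1 else 0) + (if b ∧ not c then 1 else 0)
    split true  true  = refl
    split true  false = refl
    split false _     = refl

  count+count-∁ : count P? + count (∁? P?) ≡ n
  count+count-∁ = trans (sym (∑-distrib-+ (indicator P?) (indicator (∁? P?))))
                        (trans (sum-cong-≗ (λ i → complete (does (P? i)))) count-U)
    where
    complete : ∀ b → (if b then 1 else 0) + (if not b then 1 else 0) ≡ 1
    complete true  = refl
    complete false = refl

  count-permute : (π : Permutation′ n) → count P? ≡ count (P? ∘ (π ⟨$⟩ʳ_))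
  count-permute π = sum-permute (indicator P?) π

  count-∅ : (∀ i → ¬ P i) → count P? ≡ 0
  count-∅ ¬P = trans (sum-cong-≗ (λ i → cong (λ b → if b then 1 else 0) (dec-false (P? i) (¬P i))))
                     (sum-replicate-zero n)

count-pos : {P : Pred (Fin n) ℓ} (P? : Decidable P) {x : Fin n} → P x → 0 < count P?
count-pos P? {zero} Px rewrite dec-true (P? zero) Px = s≤s z≤n
count-pos P? {suc x} Px = <-≤-trans (count-pos (P? ∘ suc) Px) (m≤n+m _ _)

length-filter-tabulate : {P : Pred A ℓ} (P? : Decidable P) (f : Fin n → A) →
                         length (filter P? (tabulate f)) ≡ count (P? ∘ f)
length-filter-tabulate {n = zero}  P? f = refl
length-filter-tabulate {n = suc n} P? f with does (P? (f zero))
... | true  = cong suc (length-filter-tabulate P? (f ∘ suc))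
... | false = length-filter-tabulate P? (f ∘ suc)

module _ {_≈_ : Rel (Fin n) ℓ} (≈-isDecEquivalence : IsDecEquivalence _≈_) where

  open IsDecEquivalence ≈-isDecEquivalence
    using () renaming (_≟_ to _≈?_; refl to ≈-refl; sym to ≈-sym; trans to ≈-trans)

  uniform-classes⇒∣ : ∀ {k} → (∀ x → count (x ≈?_) ≡ k) → k ∣ n
  uniform-classes⇒∣ {k} ∣[x]∣≡k =
    subst (k ∣_) count-U (respects⇒∣ U? (λ _ _ → _) (<-wellFounded _))
    where
    respects⇒∣ : {S : Pred (Fin n) ℓ′} (S? : Decidable S) →
                 S Respects _≈_ → Acc _<_ (count S?) → k ∣ count S?
    respects⇒∣ {S = S} S? S-resp (acc smaller⇒acc) with any? S?
    ... | no ∄S = subst (k ∣_) (sym (count-∅ S? (λ i Si → ∄S (i , Si)))) (k ∣0)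
    ... | yes (x , Sx) =
      subst (k ∣_) (sym split)
            (∣m∣n⇒∣m+n ∣-refl (respects⇒∣ rest? rest-resp (smaller⇒acc smaller)))
      where
      rest? : Decidable (S ∩ ∁ (x ≈_))
      rest? = S? ∩? ∁? (x ≈?_)

      S∩[x]≐[x] : S ∩ (x ≈_) ≐ (x ≈_)
      S∩[x]≐[x] = proj₂ , λ x≈y → S-resp x≈y Sx , x≈y

      split : count S? ≡ k + count rest?
      split = trans (count-split S? (x ≈?_))
                    (cong (_+ count rest?)
                          (trans (count-cong (S? ∩? (x ≈?_)) (x ≈?_) S∩[x]≐[x]) (∣[x]∣≡k x)))

      rest-resp : (S ∩ ∁ (x ≈_)) Respects _≈_
      rest-resp y≈z (Sy , x≉y) = S-resp y≈z Sy , λ x≈z → x≉y (≈-trans x≈z (≈-sym y≈z))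

      smaller : count rest? < count S?
      smaller = subst (count rest? <_) (sym split)
                      (m<n+m _ (subst (0 <_) (∣[x]∣≡k x) (count-pos (x ≈?_) ≈-refl)))

module _ {_∙_ : Op₂ (Fin n)} {ε : Fin n} {_⁻¹ : Op₁ (Fin n)}
         (isGroup : IsGroup _≡_ _∙_ ε _⁻¹) where

  open IsGroup isGroup using (_//_; identityˡ; inverseˡ; inverseʳ)
  private
    group : Group _ _
    group = record { isGroup = isGroup }
  open GroupProperties group using (identityˡ-unique; inverseˡ-unique; ⁻¹-anti-homo-//)
  open MonoidProperties (Group.monoid group) using (cancelʳ; cancelᶜ)

  record IsSubgroup (K : Pred (Fin n) ℓ) : Set ℓ where
    field
      ε∈K       : K ε
      ∙-closed  : ∀ {x y} → K x → K y → K (x ∙ y)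
      ⁻¹-closed : ∀ {x} → K x → K (x ⁻¹)

  module _ {K : Pred (Fin n) ℓ} (K-isSubgroup : IsSubgroup K) (K? : Decidable K) where

    open IsSubgroup K-isSubgroup

    right-coset-isDecEquivalence : IsDecEquivalence (λ x y → K (y // x))
    right-coset-isDecEquivalence = record
      { isEquivalence = record
        { refl  = λ {x} → subst K (sym (inverseʳ x)) ε∈K
        ; sym   = λ {x} {y} → subst K (⁻¹-anti-homo-// y x) ∘ ⁻¹-closed
        ; trans = λ {x} {y} {z} Kyx Kzy →
                    subst K (cancelᶜ (inverseˡ y) z (x ⁻¹)) (∙-closed Kzy Kyx)
        }
      ; _≟_ = λ x y → K? (y // x)
      }

    lagrange : count K? ∣ n
    lagrange = uniform-classes⇒∣ right-coset-isDecEquivalence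
      (λ x → sym (count-permute K? (permutation (_// x) (_∙ x)
                                      (cancelʳ (inverseʳ x)) (cancelʳ (inverseˡ x)))))

  module _ (σ : Fin n → Fin n) (σ-homo : ∀ x y → σ (x ∙ y) ≡ σ x ∙ σ y) where

    σ-ε : σ ε ≡ ε
    σ-ε = identityˡ-unique (σ ε) (σ ε) (trans (sym (σ-homo ε ε)) (cong σ (identityˡ ε)))

    σ-⁻¹ : ∀ x → σ (x ⁻¹) ≡ σ x ⁻¹
    σ-⁻¹ x = inverseˡ-unique (σ (x ⁻¹)) (σ x)
                             (trans (sym (σ-homo (x ⁻¹) x)) (trans (cong σ (inverseˡ x)) σ-ε))

    fixedPoints-isSubgroup : IsSubgroup (λ x → σ x ≡ x)
    fixedPoints-isSubgroup = record
      { ε∈K       = σ-ε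
      ; ∙-closed  = λ {x} {y} σx≡x σy≡y → trans (σ-homo x y) (cong₂ _∙_ σx≡x σy≡y)
      ; ⁻¹-closed = λ {x} σx≡x → trans (σ-⁻¹ x) (cong _⁻¹ σx≡x)
      }

index∣ : ∀ {m n} → m ∣ n → index n m ∣ n
index∣ {zero}  0∣n = 0∣n
index∣ {suc m} m∣n = m/n∣m m∣n

module _ {n : ℕ} (σ : Fin n → Fin n) (σ-involutive : ∀ x → σ (σ x) ≡ x) where

  private
    Fixed? : Decidable (λ x → σ x ≡ x)
    Fixed? x = σ x ≟ x

    Descent? : Decidable (λ x → σ x Fin.< x)
    Descent? x = σ x Fin.<? x

    Ascent? : Decidable (λ x → x Fin.< σ x)
    Ascent? x = x Fin.<? σ x

    moved∩descent≐descent : ∁ (λ x → σ x ≡ x) ∩ (λ x → σ x Fin.< x) ≐ (λ x → σ x Fin.< x)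
    moved∩descent≐descent = proj₂ , λ σx<x → (λ σx≡x → <-irrefl σx≡x σx<x) , σx<x

    moved∖descent≐ascent : ∁ (λ x → σ x ≡ x) ∩ ∁ (λ x → σ x Fin.< x) ≐ (λ x → x Fin.< σ x)
    moved∖descent≐ascent =
      moved∖descent⇒ascent , λ x<σx → (λ σx≡x → <-irrefl (sym σx≡x) x<σx) , <-asym x<σx
      where
      moved∖descent⇒ascent : ∀ {x} → σ x ≢ x × ¬ σ x Fin.< x → x Fin.< σ x
      moved∖descent⇒ascent {x} (σx≢x , σx≮x) with <-cmp (σ x) x
      ... | tri< σx<x _ _ = ⊥-elim (σx≮x σx<x)
      ... | tri≈ _ σx≡x _ = ⊥-elim (σx≢x σx≡x)
      ... | tri> _ _ x<σx = x<σx

    ascent≐descent∘σ : (λ x → x Fin.< σ x) ≐ (λ x → σ (σ x) Fin.< σ x)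
    ascent≐descent∘σ = (λ {x} → subst (Fin._< σ x) (sym (σ-involutive x)))
                     , (λ {x} → subst (Fin._< σ x) (σ-involutive x))

    -- The moved points split into descents σ x < x and ascents x < σ x, which σ swaps.
    count-moved : count (∁? Fixed?) ≡ 2 * count Descent?
    count-moved = begin
      count (∁? Fixed?)
        ≡⟨ count-split (∁? Fixed?) Descent? ⟩
      count (∁? Fixed? ∩? Descent?) + count (∁? Fixed? ∩? ∁? Descent?)
        ≡⟨ cong₂ _+_ (count-cong (∁? Fixed? ∩? Descent?) Descent? moved∩descent≐descent)
                     (count-cong (∁? Fixed? ∩? ∁? Descent?) Ascent? moved∖descent≐ascent) ⟩
      count Descent? + count Ascent?
        ≡⟨ cong (count Descent? +_) (count-cong Ascent? (Descent? ∘ σ) ascent≐descent∘σ) ⟩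
      count Descent? + count (Descent? ∘ σ)
        ≡⟨ cong (count Descent? +_) (sym (count-permute Descent? σ-permutation)) ⟩
      count Descent? + count Descent?
        ≡⟨ cong (count Descent? +_) (sym (+-identityʳ _)) ⟩
      2 * count Descent? ∎
      where
      open ≡-Reasoning
      σ-permutation : Permutation′ n
      σ-permutation = permutation σ σ σ-involutive σ-involutive

  involution-fixedPoints-parity : ∃[ k ] n ≡ 2 * k + count (λ x → σ x ≟ x)
  involution-fixedPoints-parity = count Descent? , (begin
    n                                      ≡⟨ count+count-∁ Fixed? ⟨
    count Fixed? + count (∁? Fixed?)       ≡⟨ +-comm (count Fixed?) _ ⟩
    count (∁? Fixed?) + count Fixed?       ≡⟨ cong (_+ count Fixed?) count-moved ⟩
    2 * count Descent? + count Fixed?      ∎)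
    where open ≡-Reasoning

theorem2p8 : (n : ℕ) (_∙_ : Fin n → Fin n → Fin n) (ε : Fin n) (_⁻¹ : Fin n → Fin n)
    → IsGroup _≡_ _∙_ ε _⁻¹
    → (σ : Fin n → Fin n)
    → (∀ x y → σ (x ∙ y) ≡ σ x ∙ σ y)
    → Bijective _≡_ _≡_ σ
    → (∀ h → σ (σ h) ≡ h)
    → 2 ∣ index n (∣Fix∣ σ)
    → 2 ∣ ∣Fix∣ σ
theorem2p8 n _∙_ ε _⁻¹ isGroup σ σ-homo _ σ-involutive 2∣[H:Fix] =
  subst (2 ∣_) (sym ∣Fix∣≡∣Fixed?∣) (∣m+n∣m⇒∣n 2∣2k+∣Fix∣ (m∣m*n k))
  where
  Fixed? : Decidable (λ h → σ h ≡ h)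
  Fixed? h = σ h ≟ h

  ∣Fix∣≡∣Fixed?∣ : ∣Fix∣ σ ≡ count Fixed?
  ∣Fix∣≡∣Fixed?∣ = length-filter-tabulate Fixed? id

  2∣n : 2 ∣ n
  2∣n = ∣-trans (subst (λ f → 2 ∣ index n f) ∣Fix∣≡∣Fixed?∣ 2∣[H:Fix])
                (index∣ (lagrange isGroup (fixedPoints-isSubgroup isGroup σ σ-homo) Fixed?))

  k : ℕ
  k = proj₁ (involution-fixedPoints-parity σ σ-involutive)

  2∣2k+∣Fix∣ : 2 ∣ 2 * k + count Fixed?
  2∣2k+∣Fix∣ = subst (2 ∣_) (proj₂ (involution-fixedPoints-parity σ σ-involutive)) 2∣n
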